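{- Let $\mathcal{G}$ be a triangular choice multigraph on $[m]$ and let $x,y,z$ be distinct vertices such that $m_{xy}\geq m_{xz}-1$ and the pair $xz$ is chosen in triangle $xyz$. Let $\mathcal{G}'$ be obtained from $\mathcal{G}$ by choosing $xy$ instead of $xz$ in triangle $xyz$. Then $w(\mathcal{G}',2)\geq w(\mathcal{G},2)$, with strict inequality if $m_{xy}\geq m_{xz}$. Consequently, if $w(\mathcal{G},2)=H(m,2)$, then for all distinct $x,y,z$: $m_{xy}>m_{xz}$ and $m_{xy}>m_{yz}$ if and only if $xy$ is the pair chosen in triangle $xyz$.
   Context: A triangular choice multigraph (TCM) $\mathcal{G}$ on $[m]$ is obtained by choosing, for every 3-element subset $\{u,v,w\}\subseteq[m]$, exactly one of the pairs $uv,uw,vw$ (the pair "chosen in triangle $uvw$") and adding one copy of it as an edge; $m_{xy}=m^{\mathcal{G}}_{xy}$ is the multiplicity of $xy$ in $\mathcal{G}$. $w(\mathcal{G},2)=\sum_{xy\in\binom{[m]}{2}}2^{m^{\mathcal{G}}_{xy}}$, and $H(m,2)$ is the maximum of $w(\mathcal{G},2)$ over all TCMs on $[m]$. -}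

module Defs where

open import Data.Nat using (ℕ; zero; suc; _+_; _^_; _<_; _≤_)
open import Data.Bool using (Bool; true; false; if_then_else_)
open import Data.Fin using (Fin; toℕ; _≟_) renaming (zero to fzero; suc to fsuc)
open import Data.Product using (_×_)
open import Data.Sum using (_⊎_)
open import Relation.Binary.PropositionalEquality using (_≡_; _≢_)
open import Relation.Nullary using (¬_; yes; no)
open import Relation.Nullary.Decidable using (⌊_⌋)
open import Data.Nat using (_<?_)

b2n : Bool → ℕ
b2n true  = 1
b2n false = 0

Σfin : (n : ℕ) → (Fin n → ℕ) → ℕ
Σfin zero    f = 0
Σfin (suc n) f = f fzero + Σfin n (λ i → f (fsuc i))

Distinct3 : {m : ℕ} → Fin m → Fin m → Fin m → Set
Distinct3 u v w = (u ≢ v) × (u ≢ w) × (v ≢ w)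

-- A triangular choice multigraph on [m] (vertices Fin m).
-- ch u v w = true means: the pair {u,v} is the pair chosen in triangle {u,v,w}.
-- (Values on non-distinct triples are irrelevant and never used.)
record TCM (m : ℕ) : Set where
  field
    ch      : Fin m → Fin m → Fin m → Bool
    ch-sym  : ∀ u v w → ch u v w ≡ ch v u w
    ch-one  : ∀ u v w → Distinct3 u v w →
              b2n (ch u v w) + b2n (ch u w v) + b2n (ch v w u) ≡ 1
open TCM public

Chosen : {m : ℕ} → TCM m → Fin m → Fin m → Fin m → Set
Chosen G u v w = ch G u v w ≡ true

contrib : {m : ℕ} → TCM m → Fin m → Fin m → Fin m → ℕ
contrib G x y w with w ≟ x | w ≟ y
... | yes _ | _     = 0
... | no _  | yes _ = 0
... | no _  | no _  = b2n (ch G x y w)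

mult : {m : ℕ} → TCM m → Fin m → Fin m → ℕ
mult {m} G x y = Σfin m (contrib G x y)

weight2 : {m : ℕ} → TCM m → ℕ
weight2 {m} G = Σfin m λ x → Σfin m λ y →
  if ⌊ toℕ x <? toℕ y ⌋ then 2 ^ mult G x y else 0

-- w(G,2) = H(m,2): G attains the maximum weight over all TCMs on [m]
IsMaxW : {m : ℕ} → TCM m → Set
IsMaxW {m} G = ∀ (G' : TCM m) → weight2 G' ≤ weight2 G

SameTriangle : {m : ℕ} → (u v w x y z : Fin m) → Set
SameTriangle u v w x y z =
  ((u ≡ x) × (v ≡ y) × (w ≡ z)) ⊎ ((u ≡ x) × (v ≡ z) × (w ≡ y)) ⊎
  ((u ≡ y) × (v ≡ x) × (w ≡ z)) ⊎ ((u ≡ y) × (v ≡ z) × (w ≡ x)) ⊎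
  ((u ≡ z) × (v ≡ x) × (w ≡ y)) ⊎ ((u ≡ z) × (v ≡ y) × (w ≡ x))

SwitchedAt : {m : ℕ} → TCM m → TCM m → Fin m → Fin m → Fin m → Set
SwitchedAt G G' x y z =
  Chosen G' x y z ×
  (∀ u v w → Distinct3 u v w → ¬ SameTriangle u v w x y z →
     ch G' u v w ≡ ch G u v w)

-- Switching the choice in triangle xyz from xz to xy changes only two multiplicities:
-- m_xy goes up by one and m_xz down by one.  Hence w(G',2) - w(G,2) = 2^{m_xy} - 2^{m_xz - 1},
-- which is nonnegative when m_xz - 1 ≤ m_xy and positive when m_xz ≤ m_xy.  Since such a
-- switch always exists, in a maximum TCM the chosen pair of every triangle is strictly
-- heavier than the two others; as some pair of each triangle is chosen, this characterises it.
module Submission where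

open import Defs
open import Data.Bool using (Bool; true; false; if_then_else_)
open import Data.Fin using (Fin; toℕ; _≟_) renaming (zero to fzero; suc to fsuc)
open import Data.Fin.Properties using (toℕ-injective) renaming (suc-injective to fsuc-injective)
open import Data.Fin.Permutation.Components using (transpose; transpose-inverse)
open import Data.Nat using (ℕ; zero; suc; _+_; _*_; _^_; _<_; _≤_; _<?_; s≤s⁻¹)
open import Data.Nat.Properties
  using (+-assoc; +-comm; +-identityʳ; +-cancelʳ-≡; +-cancelʳ-≤; +-cancelʳ-<; +-monoʳ-≤;
         +-monoʳ-<; ^-monoʳ-≤; ^-monoʳ-<; ≤-trans; ≤-reflexive; ≤-<-trans; <-cmp; <-asym;
         <-irrefl; <⇒≱; ≰⇒>; n<1+n; +-commutativeSemigroup)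
open import Algebra.Properties.CommutativeSemigroup +-commutativeSemigroup
  using (xy∙z≈xz∙y; xy∙z≈zy∙x)
open import Data.Nat.Tactic.RingSolver using (solve)
open import Data.List using (_∷_; [])
open import Data.Product using (_×_; _,_; proj₁; proj₂; ∃₂)
open import Data.Sum using (_⊎_; inj₁; inj₂; [_,_]′)
open import Data.Empty using (⊥-elim)
open import Function using (_∘_)
open import Function.Bundles using (_⇔_; mk⇔)
open import Relation.Binary.Definitions using (tri<; tri≈; tri>)
open import Relation.Binary.PropositionalEquality
open import Relation.Nullary using (Dec; yes; no; does; ¬_)
open import Relation.Nullary.Decidable using (⌊_⌋; dec-true; dec-false; does-⇔; _×-dec_; _⊎-dec_)

+-exchange : ∀ {a b c d e f} → a + d ≡ b + c → c + f ≡ d + e → a + f ≡ b + e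
+-exchange {a} {b} {c} {d} {e} {f} ad≡bc cf≡de = +-cancelʳ-≡ (c + d) (a + f) (b + e) (begin
  a + f + (c + d)    ≡⟨ solve (a ∷ c ∷ d ∷ f ∷ []) ⟩
  a + d + (c + f)    ≡⟨ cong₂ _+_ ad≡bc cf≡de ⟩
  b + c + (d + e)    ≡⟨ solve (b ∷ c ∷ d ∷ e ∷ []) ⟩
  b + e + (c + d)    ∎)
  where open ≡-Reasoning

+-exchange-≤ : ∀ {w w' a b} → w + a ≡ w' + b → b ≤ a → w ≤ w'
+-exchange-≤ {w} {w'} {a} e b≤a = +-cancelʳ-≤ a w w' (≤-trans (≤-reflexive e) (+-monoʳ-≤ w' b≤a))

+-exchange-< : ∀ {w w' a b} → w + a ≡ w' + b → b < a → w < w'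
+-exchange-< {w} {w'} {a} e b<a = +-cancelʳ-< a w w' (≤-<-trans (≤-reflexive e) (+-monoʳ-< w' b<a))

double-exchange : ∀ w w' a b → w + 2 * a + b ≡ w' + a + 2 * b → w + a ≡ w' + b
double-exchange w w' a b e = +-cancelʳ-≡ (a + b) (w + a) (w' + b) (begin
  w + a + (a + b)    ≡⟨ solve (w ∷ a ∷ b ∷ []) ⟩
  w + 2 * a + b      ≡⟨ e ⟩
  w' + a + 2 * b     ≡⟨ solve (w' ∷ a ∷ b ∷ []) ⟩
  w' + b + (a + b)   ∎)
  where open ≡-Reasoning

Σfin-cong : ∀ n {f g : Fin n → ℕ} → (∀ i → f i ≡ g i) → Σfin n f ≡ Σfin n g
Σfin-cong zero    f≗g = refl
Σfin-cong (suc n) f≗g = cong₂ _+_ (f≗g fzero) (Σfin-cong n (f≗g ∘ fsuc))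

Σfin-update : ∀ n {f g : Fin n → ℕ} (p : Fin n) → (∀ i → i ≢ p → f i ≡ g i) →
              Σfin n f + g p ≡ Σfin n g + f p
Σfin-update (suc n) {f} {g} fzero f≗g = begin
  f fzero + Σfin n (f ∘ fsuc) + g fzero
    ≡⟨ cong (λ s → f fzero + s + g fzero) (Σfin-cong n λ i → f≗g (fsuc i) λ ()) ⟩
  f fzero + Σfin n (g ∘ fsuc) + g fzero
    ≡⟨ xy∙z≈zy∙x (f fzero) _ (g fzero) ⟩
  g fzero + Σfin n (g ∘ fsuc) + f fzero ∎
  where open ≡-Reasoning
Σfin-update (suc n) {f} {g} (fsuc p) f≗g = begin
  f fzero + Σfin n (f ∘ fsuc) + g (fsuc p)
    ≡⟨ +-assoc (f fzero) _ _ ⟩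
  f fzero + (Σfin n (f ∘ fsuc) + g (fsuc p))
    ≡⟨ cong₂ _+_ (f≗g fzero λ ()) (Σfin-update n p λ i i≢p → f≗g (fsuc i) (i≢p ∘ fsuc-injective)) ⟩
  g fzero + (Σfin n (g ∘ fsuc) + f (fsuc p))
    ≡⟨ +-assoc (g fzero) _ _ ⟨
  g fzero + Σfin n (g ∘ fsuc) + f (fsuc p) ∎
  where open ≡-Reasoning

ΣΣ : ∀ n → (Fin n → Fin n → ℕ) → ℕ
ΣΣ n T = Σfin n λ i → Σfin n (T i)

ΣΣ-update : ∀ n (T T' : Fin n → Fin n → ℕ) (p q : Fin n) →
            (∀ i j → ¬ (i ≡ p × j ≡ q) → T i j ≡ T' i j) →
            ΣΣ n T + T' p q ≡ ΣΣ n T' + T p q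
ΣΣ-update n T T' p q agree = +-exchange {c = Σfin n (T p)} {d = Σfin n (T' p)}
  (Σfin-update n p λ i i≢p → Σfin-cong n λ j → agree i j (i≢p ∘ proj₁))
  (Σfin-update n q λ j j≢q → agree p j (j≢q ∘ proj₂))

ΣΣ-update₂ : ∀ n (T T' : Fin n → Fin n → ℕ) (p₁ q₁ p₂ q₂ : Fin n) → ¬ (p₂ ≡ p₁ × q₂ ≡ q₁) →
             (∀ i j → ¬ (i ≡ p₁ × j ≡ q₁) → ¬ (i ≡ p₂ × j ≡ q₂) → T i j ≡ T' i j) →
             ΣΣ n T + T' p₁ q₁ + T' p₂ q₂ ≡ ΣΣ n T' + T p₁ q₁ + T p₂ q₂
ΣΣ-update₂ n T T' p₁ q₁ p₂ q₂ p₂q₂≢p₁q₁ agree = begin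
  ΣΣ n T + T' p₁ q₁ + T' p₂ q₂
    ≡⟨ cong (λ s → ΣΣ n T + s + T' p₂ q₂) M-at-p₁q₁ ⟨
  ΣΣ n T + M p₁ q₁ + T' p₂ q₂
    ≡⟨ cong (_+ T' p₂ q₂) (ΣΣ-update n T M p₁ q₁ T≗M) ⟩
  ΣΣ n M + T p₁ q₁ + T' p₂ q₂
    ≡⟨ xy∙z≈xz∙y (ΣΣ n M) _ _ ⟩
  ΣΣ n M + T' p₂ q₂ + T p₁ q₁
    ≡⟨ cong (_+ T p₁ q₁) (ΣΣ-update n M T' p₂ q₂ M≗T') ⟩
  ΣΣ n T' + M p₂ q₂ + T p₁ q₁
    ≡⟨ cong (λ s → ΣΣ n T' + s + T p₁ q₁) (T≗M p₂ q₂ p₂q₂≢p₁q₁) ⟨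
  ΣΣ n T' + T p₂ q₂ + T p₁ q₁
    ≡⟨ xy∙z≈xz∙y (ΣΣ n T') _ _ ⟩
  ΣΣ n T' + T p₁ q₁ + T p₂ q₂ ∎
  where
  open ≡-Reasoning
  M : Fin n → Fin n → ℕ
  M i j = if does ((i ≟ p₁) ×-dec (j ≟ q₁)) then T' i j else T i j
  M-at-p₁q₁ : M p₁ q₁ ≡ T' p₁ q₁
  M-at-p₁q₁ rewrite dec-true ((p₁ ≟ p₁) ×-dec (q₁ ≟ q₁)) (refl , refl) = refl
  T≗M : ∀ i j → ¬ (i ≡ p₁ × j ≡ q₁) → T i j ≡ M i j
  T≗M i j ≢p₁q₁ rewrite dec-false ((i ≟ p₁) ×-dec (j ≟ q₁)) ≢p₁q₁ = refl
  M≗T' : ∀ i j → ¬ (i ≡ p₂ × j ≡ q₂) → M i j ≡ T' i j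
  M≗T' i j ≢p₂q₂ with (i ≟ p₁) ×-dec (j ≟ q₁)
  ... | yes (refl , refl) = M-at-p₁q₁
  ... | no  ≢p₁q₁        = trans (sym (T≗M i j ≢p₁q₁)) (agree i j ≢p₁q₁ ≢p₂q₂)

SamePair : ∀ {m} → Fin m → Fin m → Fin m → Fin m → Set
SamePair i j a b = (i ≡ a × j ≡ b) ⊎ (i ≡ b × j ≡ a)

SamePair-shared : ∀ {m} {p q a b c d : Fin m} → SamePair p q a b → SamePair p q c d → SamePair c d a b
SamePair-shared (inj₁ (refl , refl)) (inj₁ (refl , refl)) = inj₁ (refl , refl)
SamePair-shared (inj₁ (refl , refl)) (inj₂ (refl , refl)) = inj₂ (refl , refl)
SamePair-shared (inj₂ (refl , refl)) (inj₁ (refl , refl)) = inj₂ (refl , refl)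
SamePair-shared (inj₂ (refl , refl)) (inj₂ (refl , refl)) = inj₁ (refl , refl)

ordered : ∀ {m} {a b : Fin m} → a ≢ b → ∃₂ λ p q → SamePair p q a b × toℕ p < toℕ q
ordered {a = a} {b} a≢b with <-cmp (toℕ a) (toℕ b)
... | tri< a<b _ _ = a , b , inj₁ (refl , refl) , a<b
... | tri≈ _ a≡b _ = ⊥-elim (a≢b (toℕ-injective a≡b))
... | tri> _ _ b<a = b , a , inj₂ (refl , refl) , b<a

ordered-unique : ∀ {m} {i j p q a b : Fin m} → SamePair i j a b → SamePair p q a b →
                 toℕ i < toℕ j → toℕ p < toℕ q → i ≡ p × j ≡ q
ordered-unique (inj₁ (refl , refl)) (inj₁ (refl , refl)) _   _   = refl , refl
ordered-unique (inj₁ (refl , refl)) (inj₂ (refl , refl)) i<j p<q = ⊥-elim (<-asym i<j p<q)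
ordered-unique (inj₂ (refl , refl)) (inj₁ (refl , refl)) i<j p<q = ⊥-elim (<-asym i<j p<q)
ordered-unique (inj₂ (refl , refl)) (inj₂ (refl , refl)) _   _   = refl , refl

upper : ∀ {m} → (Fin m → Fin m → ℕ) → Fin m → Fin m → ℕ
upper φ i j = if ⌊ toℕ i <? toℕ j ⌋ then φ i j else 0

-- weight2 G is definitionally upperSum m (λ i j → 2 ^ mult G i j).
upperSum : ∀ m → (Fin m → Fin m → ℕ) → ℕ
upperSum m φ = ΣΣ m (upper φ)

upper-at : ∀ {m} (φ : Fin m → Fin m → ℕ) → (∀ i j → φ i j ≡ φ j i) →
           ∀ {p q a b} → SamePair p q a b → toℕ p < toℕ q → upper φ p q ≡ φ a b
upper-at φ φ-sym {p} {q} pq≈ab p<q with toℕ p <? toℕ q | pq≈ab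
... | no p≮q | _                  = ⊥-elim (p≮q p<q)
... | yes _  | inj₁ (refl , refl) = refl
... | yes _  | inj₂ (refl , refl) = φ-sym p q

upperSum-update₂ : ∀ m (φ ψ : Fin m → Fin m → ℕ) → (∀ i j → φ i j ≡ φ j i) → (∀ i j → ψ i j ≡ ψ j i) →
                   ∀ {a b c d} → a ≢ b → c ≢ d → ¬ SamePair c d a b →
                   (∀ i j → i ≢ j → ¬ SamePair i j a b → ¬ SamePair i j c d → φ i j ≡ ψ i j) →
                   upperSum m φ + ψ a b + ψ c d ≡ upperSum m ψ + φ a b + φ c d
upperSum-update₂ m φ ψ φ-sym ψ-sym a≢b c≢d cd≉ab agree
  with ordered a≢b | ordered c≢d
... | p₁ , q₁ , p₁q₁≈ab , p₁<q₁ | p₂ , q₂ , p₂q₂≈cd , p₂<q₂ = begin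
  upperSum m φ + ψ _ _ + ψ _ _
    ≡⟨ cong₂ (λ s t → upperSum m φ + s + t) (ψ-at p₁q₁≈ab p₁<q₁) (ψ-at p₂q₂≈cd p₂<q₂) ⟨
  upperSum m φ + upper ψ p₁ q₁ + upper ψ p₂ q₂
    ≡⟨ ΣΣ-update₂ m (upper φ) (upper ψ) p₁ q₁ p₂ q₂ p₂q₂≢p₁q₁ upper-agree ⟩
  upperSum m ψ + upper φ p₁ q₁ + upper φ p₂ q₂
    ≡⟨ cong₂ (λ s t → upperSum m ψ + s + t) (φ-at p₁q₁≈ab p₁<q₁) (φ-at p₂q₂≈cd p₂<q₂) ⟩
  upperSum m ψ + φ _ _ + φ _ _ ∎
  where
  open ≡-Reasoning
  φ-at = upper-at φ φ-sym
  ψ-at = upper-at ψ ψ-sym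
  p₂q₂≢p₁q₁ : ¬ (p₂ ≡ p₁ × q₂ ≡ q₁)
  p₂q₂≢p₁q₁ (refl , refl) = cd≉ab (SamePair-shared p₁q₁≈ab p₂q₂≈cd)
  upper-agree : ∀ i j → ¬ (i ≡ p₁ × j ≡ q₁) → ¬ (i ≡ p₂ × j ≡ q₂) → upper φ i j ≡ upper ψ i j
  upper-agree i j ≢p₁q₁ ≢p₂q₂ with toℕ i <? toℕ j
  ... | no  _   = refl
  ... | yes i<j = agree i j (λ { refl → <-irrefl refl i<j })
                    (λ ij≈ab → ≢p₁q₁ (ordered-unique ij≈ab p₁q₁≈ab i<j p₁<q₁))
                    (λ ij≈cd → ≢p₂q₂ (ordered-unique ij≈cd p₂q₂≈cd i<j p₂<q₂))

one-hot : ∀ {b c} → b2n true + b2n b + b2n c ≡ 1 → b ≡ false × c ≡ false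
one-hot {false} {false} _ = refl , refl
one-hot {false} {true}  ()
one-hot {true}          ()

one-of-three : ∀ a b c → b2n a + b2n b + b2n c ≡ 1 → a ≡ true ⊎ b ≡ true ⊎ c ≡ true
one-of-three true  _     _    _  = inj₁ refl
one-of-three false true  _    _  = inj₂ (inj₁ refl)
one-of-three false false true _  = inj₂ (inj₂ refl)
one-of-three false false false ()

module _ {m : ℕ} where

  some-chosen : (G : TCM m) {u v w : Fin m} → Distinct3 u v w →
                Chosen G u v w ⊎ Chosen G u w v ⊎ Chosen G v w u
  some-chosen G {u} {v} {w} d = one-of-three _ _ _ (ch-one G u v w d)

  chosen-excludes : (G : TCM m) {u v w : Fin m} → Distinct3 u v w → Chosen G u v w →
                    ch G u w v ≡ false × ch G v w u ≡ false
  chosen-excludes G {u} {v} {w} d uv-chosen =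
    one-hot (subst (λ t → b2n t + b2n (ch G u w v) + b2n (ch G v w u) ≡ 1) uv-chosen (ch-one G u v w d))

  contrib-sym : (G : TCM m) (u v w : Fin m) → contrib G u v w ≡ contrib G v u w
  contrib-sym G u v w with w ≟ u | w ≟ v
  ... | yes _ | yes _ = refl
  ... | yes _ | no  _ = refl
  ... | no  _ | yes _ = refl
  ... | no  _ | no  _ = cong b2n (ch-sym G u v w)

  mult-sym : (G : TCM m) (u v : Fin m) → mult G u v ≡ mult G v u
  mult-sym G u v = Σfin-cong m (contrib-sym G u v)

  contrib-third : (G : TCM m) {u v w : Fin m} → w ≢ u → w ≢ v → contrib G u v w ≡ b2n (ch G u v w)
  contrib-third G {u} {v} {w} w≢u w≢v with w ≟ u | w ≟ v
  ... | yes w≡u | _       = ⊥-elim (w≢u w≡u)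
  ... | no  _   | yes w≡v = ⊥-elim (w≢v w≡v)
  ... | no  _   | no  _   = refl

  contrib-cong : (G G' : TCM m) {u v w : Fin m} → (w ≢ u → w ≢ v → ch G u v w ≡ ch G' u v w) →
                 contrib G u v w ≡ contrib G' u v w
  contrib-cong G G' {u} {v} {w} agree with w ≟ u | w ≟ v
  ... | yes _   | _       = refl
  ... | no  _   | yes _   = refl
  ... | no  w≢u | no  w≢v = cong b2n (agree w≢u w≢v)

  mult-cong : (G G' : TCM m) {u v : Fin m} → (∀ w → w ≢ u → w ≢ v → ch G u v w ≡ ch G' u v w) →
              mult G u v ≡ mult G' u v
  mult-cong G G' agree = Σfin-cong m λ w → contrib-cong G G' (agree w)

  mult-suc : (G G' : TCM m) {u v : Fin m} (z : Fin m) → z ≢ u → z ≢ v →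
             (∀ w → w ≢ u → w ≢ v → w ≢ z → ch G u v w ≡ ch G' u v w) →
             ch G u v z ≡ false → ch G' u v z ≡ true → mult G' u v ≡ suc (mult G u v)
  mult-suc G G' {u} {v} z z≢u z≢v agree G-false G'-true = begin
    mult G' u v                   ≡⟨ +-identityʳ _ ⟨
    mult G' u v + 0               ≡⟨ cong (mult G' u v +_) (trans (contrib-third G z≢u z≢v) (cong b2n G-false)) ⟨
    mult G' u v + contrib G u v z ≡⟨ Σfin-update m z (λ w w≢z → contrib-cong G G' λ w≢u w≢v → agree w w≢u w≢v w≢z) ⟨
    mult G u v + contrib G' u v z ≡⟨ cong (mult G u v +_) (trans (contrib-third G' z≢u z≢v) (cong b2n G'-true)) ⟩
    mult G u v + 1                ≡⟨ +-comm _ 1 ⟩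
    suc (mult G u v)              ∎
    where open ≡-Reasoning

pattern as-xyz = inj₁ (refl , refl , refl)
pattern as-xzy = inj₂ (inj₁ (refl , refl , refl))
pattern as-yxz = inj₂ (inj₂ (inj₁ (refl , refl , refl)))
pattern as-yzx = inj₂ (inj₂ (inj₂ (inj₁ (refl , refl , refl))))
pattern as-zxy = inj₂ (inj₂ (inj₂ (inj₂ (inj₁ (refl , refl , refl)))))
pattern as-zyx = inj₂ (inj₂ (inj₂ (inj₂ (inj₂ (refl , refl , refl)))))

module _ {m : ℕ} where

  sameTriangle? : (u v w x y z : Fin m) → Dec (SameTriangle u v w x y z)
  sameTriangle? u v w x y z =
    (u ≟ x ×-dec v ≟ y ×-dec w ≟ z) ⊎-dec (u ≟ x ×-dec v ≟ z ×-dec w ≟ y) ⊎-dec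
    (u ≟ y ×-dec v ≟ x ×-dec w ≟ z) ⊎-dec (u ≟ y ×-dec v ≟ z ×-dec w ≟ x) ⊎-dec
    (u ≟ z ×-dec v ≟ x ×-dec w ≟ y) ⊎-dec (u ≟ z ×-dec v ≟ y ×-dec w ≟ x)

  SameTriangle-swap₁₂ : {u v w x y z : Fin m} → SameTriangle u v w x y z → SameTriangle v u w x y z
  SameTriangle-swap₁₂ as-xyz = as-yxz
  SameTriangle-swap₁₂ as-xzy = as-zxy
  SameTriangle-swap₁₂ as-yxz = as-xyz
  SameTriangle-swap₁₂ as-yzx = as-zyx
  SameTriangle-swap₁₂ as-zxy = as-xzy
  SameTriangle-swap₁₂ as-zyx = as-yzx

  SameTriangle-swap₂₃ : {u v w x y z : Fin m} → SameTriangle u v w x y z → SameTriangle u w v x y z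
  SameTriangle-swap₂₃ as-xyz = as-xzy
  SameTriangle-swap₂₃ as-xzy = as-xyz
  SameTriangle-swap₂₃ as-yxz = as-yzx
  SameTriangle-swap₂₃ as-yzx = as-yxz
  SameTriangle-swap₂₃ as-zxy = as-zyx
  SameTriangle-swap₂₃ as-zyx = as-zxy

  SameTriangle-third : {u v w x y z : Fin m} → SameTriangle u v w x y z → w ≡ x ⊎ w ≡ y ⊎ w ≡ z
  SameTriangle-third as-xyz = inj₂ (inj₂ refl)
  SameTriangle-third as-xzy = inj₂ (inj₁ refl)
  SameTriangle-third as-yxz = inj₂ (inj₂ refl)
  SameTriangle-third as-yzx = inj₁ refl
  SameTriangle-third as-zxy = inj₂ (inj₁ refl)
  SameTriangle-third as-zyx = inj₁ refl

module Switch {m} {G G' : TCM m} {x y z : Fin m} (d : Distinct3 x y z)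
              (xz-chosen : Chosen G x z y) (switched : SwitchedAt G G' x y z) where

  private
    x≢y = proj₁ d
    x≢z = proj₁ (proj₂ d)
    y≢z = proj₂ (proj₂ d)

    G-xy : ch G x y z ≡ false
    G-xy = proj₁ (chosen-excludes G (x≢z , x≢y , ≢-sym y≢z) xz-chosen)

    G-yz : ch G y z x ≡ false
    G-yz = trans (ch-sym G y z x) (proj₂ (chosen-excludes G (x≢z , x≢y , ≢-sym y≢z) xz-chosen))

    G'-xz : ch G' x z y ≡ false
    G'-xz = proj₁ (chosen-excludes G' d (proj₁ switched))

    G'-yz : ch G' y z x ≡ false
    G'-yz = proj₂ (chosen-excludes G' d (proj₁ switched))

    agrees-off-triangle : ∀ {u v w} → Distinct3 u v w → w ≢ x → w ≢ y → w ≢ z → ch G u v w ≡ ch G' u v w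
    agrees-off-triangle {u} {v} {w} duvw w≢x w≢y w≢z =
      sym (proj₂ switched u v w duvw λ t → [ w≢x , [ w≢y , w≢z ]′ ]′ (SameTriangle-third t))

    agrees-on-other-pairs : ∀ {u v w} → Distinct3 u v w → ¬ SamePair u v x y → ¬ SamePair u v x z →
                            ch G u v w ≡ ch G' u v w
    agrees-on-other-pairs {u} {v} {w} duvw ≉xy ≉xz with sameTriangle? u v w x y z
    ... | no  ≉xyz  = sym (proj₂ switched u v w duvw ≉xyz)
    ... | yes as-xyz = ⊥-elim (≉xy (inj₁ (refl , refl)))
    ... | yes as-xzy = ⊥-elim (≉xz (inj₁ (refl , refl)))
    ... | yes as-yxz = ⊥-elim (≉xy (inj₂ (refl , refl)))
    ... | yes as-yzx = trans G-yz (sym G'-yz)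
    ... | yes as-zxy = ⊥-elim (≉xz (inj₂ (refl , refl)))
    ... | yes as-zyx = trans (ch-sym G z y x) (trans G-yz (sym (trans (ch-sym G' z y x) G'-yz)))

    mult-xy : mult G' x y ≡ suc (mult G x y)
    mult-xy = mult-suc G G' z (≢-sym x≢z) (≢-sym y≢z)
      (λ w w≢x w≢y w≢z → agrees-off-triangle (x≢y , ≢-sym w≢x , ≢-sym w≢y) w≢x w≢y w≢z)
      G-xy (proj₁ switched)

    mult-xz : mult G x z ≡ suc (mult G' x z)
    mult-xz = mult-suc G' G y (≢-sym x≢y) y≢z
      (λ w w≢x w≢z w≢y → sym (agrees-off-triangle (x≢z , ≢-sym w≢x , ≢-sym w≢z) w≢x w≢y w≢z))
      G'-xz xz-chosen

    mult-other : ∀ i j → i ≢ j → ¬ SamePair i j x y → ¬ SamePair i j x z → mult G i j ≡ mult G' i j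
    mult-other i j i≢j ≉xy ≉xz =
      mult-cong G G' λ w w≢i w≢j → agrees-on-other-pairs (i≢j , ≢-sym w≢i , ≢-sym w≢j) ≉xy ≉xz

  weight-exchange : weight2 G + 2 ^ mult G x y ≡ weight2 G' + 2 ^ mult G' x z
  weight-exchange = double-exchange _ _ (2 ^ mult G x y) (2 ^ mult G' x z) exchanged
    where
    xz≉xy : ¬ SamePair x z x y
    xz≉xy (inj₁ (_ , z≡y)) = y≢z (sym z≡y)
    xz≉xy (inj₂ (x≡y , _)) = x≢y x≡y
    exchanged : weight2 G + 2 ^ suc (mult G x y) + 2 ^ mult G' x z ≡
                weight2 G' + 2 ^ mult G x y + 2 ^ suc (mult G' x z)
    exchanged = subst₂ (λ s t → weight2 G + 2 ^ s + 2 ^ mult G' x z ≡ weight2 G' + 2 ^ mult G x y + 2 ^ t)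
      mult-xy mult-xz (upperSum-update₂ m (λ i j → 2 ^ mult G i j) (λ i j → 2 ^ mult G' i j)
        (λ i j → cong (2 ^_) (mult-sym G i j)) (λ i j → cong (2 ^_) (mult-sym G' i j))
        x≢y x≢z xz≉xy (λ i j i≢j ≉xy ≉xz → cong (2 ^_) (mult-other i j i≢j ≉xy ≉xz)))

  weight-≤ : mult G x z ≤ mult G x y + 1 → weight2 G ≤ weight2 G'
  weight-≤ xz≤xy+1 = +-exchange-≤ weight-exchange (^-monoʳ-≤ 2 xz'≤xy)
    where
    xz'≤xy : mult G' x z ≤ mult G x y
    xz'≤xy = s≤s⁻¹ (subst₂ _≤_ mult-xz (+-comm (mult G x y) 1) xz≤xy+1)

  weight-< : mult G x z ≤ mult G x y → weight2 G < weight2 G'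
  weight-< xz≤xy = +-exchange-< weight-exchange (^-monoʳ-< 2 (n<1+n 1) (subst (_≤ mult G x y) mult-xz xz≤xy))

-- Inside triangle xyz the choice of G is transported by the transposition of y and z, so the
-- chosen pair xz of G becomes xy; all other triangles keep the choice of G.
module Switching {m} (G : TCM m) (x y z : Fin m) where

  private
    τ : Fin m → Fin m
    τ = transpose y z

    τ-injective : ∀ {a b} → τ a ≡ τ b → a ≡ b
    τ-injective {a} {b} τa≡τb =
      trans (sym (transpose-inverse z y)) (trans (cong (transpose z y) τa≡τb) (transpose-inverse z y))

    inTriangle : Fin m → Fin m → Fin m → Bool
    inTriangle u v w = does (sameTriangle? u v w x y z)

    inTriangle-swap₁₂ : ∀ u v w → inTriangle u v w ≡ inTriangle v u w
    inTriangle-swap₁₂ u v w = does-⇔ (mk⇔ SameTriangle-swap₁₂ SameTriangle-swap₁₂) (sameTriangle? u v w x y z) (sameTriangle? v u w x y z)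

    inTriangle-swap₂₃ : ∀ u v w → inTriangle u v w ≡ inTriangle u w v
    inTriangle-swap₂₃ u v w = does-⇔ (mk⇔ SameTriangle-swap₂₃ SameTriangle-swap₂₃) (sameTriangle? u v w x y z) (sameTriangle? u w v x y z)

    choice : Fin m → Fin m → Fin m → Bool
    choice u v w = if inTriangle u v w then ch G (τ u) (τ v) (τ w) else ch G u v w

    choice-sym : ∀ u v w → choice u v w ≡ choice v u w
    choice-sym u v w rewrite inTriangle-swap₁₂ u v w with inTriangle v u w
    ... | true  = ch-sym G (τ u) (τ v) (τ w)
    ... | false = ch-sym G u v w

    choice-one : ∀ u v w → Distinct3 u v w → b2n (choice u v w) + b2n (choice u w v) + b2n (choice v w u) ≡ 1
    choice-one u v w (u≢v , u≢w , v≢w)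
      rewrite sym (inTriangle-swap₂₃ u v w)
            | sym (trans (inTriangle-swap₁₂ u v w) (inTriangle-swap₂₃ v u w))
      with inTriangle u v w
    ... | true  = ch-one G (τ u) (τ v) (τ w) (u≢v ∘ τ-injective , u≢w ∘ τ-injective , v≢w ∘ τ-injective)
    ... | false = ch-one G u v w (u≢v , u≢w , v≢w)

  switch : TCM m
  switch = record { ch = choice ; ch-sym = choice-sym ; ch-one = choice-one }

  switch-SwitchedAt : Distinct3 x y z → Chosen G x z y → SwitchedAt G switch x y z
  switch-SwitchedAt (x≢y , x≢z , y≢z) xz-chosen = chooses-xy , agrees
    where
    τx≡x : τ x ≡ x
    τx≡x rewrite dec-false (x ≟ y) x≢y | dec-false (x ≟ z) x≢z = refl
    τy≡z : τ y ≡ z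
    τy≡z rewrite dec-true (y ≟ y) refl = refl
    τz≡y : τ z ≡ y
    τz≡y rewrite dec-false (z ≟ y) (≢-sym y≢z) | dec-true (z ≟ z) refl = refl
    chooses-xy : Chosen switch x y z
    chooses-xy rewrite dec-true (sameTriangle? x y z x y z) as-xyz | τx≡x | τy≡z | τz≡y = xz-chosen
    agrees : ∀ u v w → Distinct3 u v w → ¬ SameTriangle u v w x y z → choice u v w ≡ ch G u v w
    agrees u v w _ ≉xyz rewrite dec-false (sameTriangle? u v w x y z) ≉xyz = refl

module _ {m : ℕ} {G : TCM m} (G-max : IsMaxW G) where

  IsMaxW⇒chosen-heavier : ∀ {a b c} → Distinct3 a b c → Chosen G a c b → mult G a b < mult G a c
  IsMaxW⇒chosen-heavier {a} {b} {c} d ac-chosen = ≰⇒> λ ac≤ab →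
    <⇒≱ (Switch.weight-< d ac-chosen (switch-SwitchedAt d ac-chosen) ac≤ab) (G-max switch)
    where open Switching G a b c

  IsMaxW⇒chosen⇔heaviest : ∀ {x y z} → Distinct3 x y z →
                           ((mult G x z < mult G x y) × (mult G y z < mult G x y)) ⇔ Chosen G x y z
  IsMaxW⇒chosen⇔heaviest {x} {y} {z} d@(x≢y , x≢z , y≢z) = mk⇔ heaviest⇒chosen chosen⇒heaviest
    where
    heaviest⇒chosen : (mult G x z < mult G x y) × (mult G y z < mult G x y) → Chosen G x y z
    heaviest⇒chosen (xz<xy , yz<xy) with some-chosen G d
    ... | inj₁ xy-chosen        = xy-chosen
    ... | inj₂ (inj₁ xz-chosen) = ⊥-elim (<-asym xz<xy (IsMaxW⇒chosen-heavier d xz-chosen))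
    ... | inj₂ (inj₂ yz-chosen) = ⊥-elim (<-asym yz<xy
            (subst (_< mult G y z) (mult-sym G y x) (IsMaxW⇒chosen-heavier (≢-sym x≢y , y≢z , x≢z) yz-chosen)))
    chosen⇒heaviest : Chosen G x y z → (mult G x z < mult G x y) × (mult G y z < mult G x y)
    chosen⇒heaviest xy-chosen =
      IsMaxW⇒chosen-heavier (x≢z , x≢y , ≢-sym y≢z) xy-chosen ,
      subst (mult G y z <_) (mult-sym G y x)
        (IsMaxW⇒chosen-heavier (y≢z , ≢-sym x≢y , ≢-sym x≢z) (trans (ch-sym G y x z) xy-chosen))

lemma4p3 :
    (∀ (m : ℕ) (G G' : TCM m) (x y z : Fin m) → Distinct3 x y z →
      mult G x z ≤ mult G x y + 1 → Chosen G x z y → SwitchedAt G G' x y z →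
      (weight2 G ≤ weight2 G') × (mult G x z ≤ mult G x y → weight2 G < weight2 G'))
    ×
    (∀ (m : ℕ) (G : TCM m) → IsMaxW G → ∀ (x y z : Fin m) → Distinct3 x y z →
      (((mult G x z < mult G x y) × (mult G y z < mult G x y)) ⇔ Chosen G x y z))
lemma4p3 =
  (λ m G G' x y z d xz≤xy+1 xz-chosen switched →
    Switch.weight-≤ d xz-chosen switched xz≤xy+1 , Switch.weight-< d xz-chosen switched) ,
  (λ m G G-max x y z → IsMaxW⇒chosen⇔heaviest G-max)
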